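{- For every tree $T$, $|\mathrm{Leaves}(T)| \cdot \mathrm{diam}(T) + 1 \geq |V(T)|$.
   Context: $\mathrm{Leaves}(T)$ is the set of vertices of degree $1$ in $T$, and $\mathrm{diam}(T)$ is the maximum number of edges of a path in $T$. -}

module Defs where

open import Data.Nat using (ℕ; zero; suc; _≤_)
open import Data.Bool using (Bool; true; false; T)
open import Data.Fin using (Fin; fromℕ) renaming (zero to fzero)
open import Data.List using (List; length; filter)
open import Data.List.Base using (allFin)
open import Data.Vec using (Vec; []; _∷_; lookup; toList)
open import Data.Vec.Relation.Unary.Linked using (Linked)
open import Data.List.Relation.Unary.Unique.Propositional using (Unique)
open import Data.Product using (Σ; _×_; ∃)
open import Relation.Binary.PropositionalEquality using (_≡_)
open import Relation.Nullary using (¬_)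
open import Data.Nat.Properties using () renaming (_≟_ to _≟ℕ_)

record Graph (n : ℕ) : Set where
  field
    adj       : Fin n → Fin n → Bool
    symmetric : ∀ u v → adj u v ≡ adj v u
    loopless  : ∀ v → adj v v ≡ false
open Graph public

Adj : ∀ {n} → Graph n → Fin n → Fin n → Set
Adj G u v = T (adj G u v)

-- A path with k edges: k+1 pairwise distinct vertices, consecutive ones adjacent.
record Path {n : ℕ} (G : Graph n) (k : ℕ) : Set where
  field
    verts    : Vec (Fin n) (suc k)
    adjacent : Linked (Adj G) verts
    distinct : Unique (toList verts)
open Path public

Connected : ∀ {n} → Graph n → Set
Connected G = ∀ u v → Σ ℕ λ k → Σ (Path G k) λ p →
  (lookup (verts p) fzero ≡ u) × (lookup (verts p) (fromℕ k) ≡ v)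

HasCycle : ∀ {n} → Graph n → Set
HasCycle G = Σ ℕ λ k → Σ (Path G (suc (suc k))) λ p →
  Adj G (lookup (verts p) (fromℕ (suc (suc k)))) (lookup (verts p) fzero)

Acyclic : ∀ {n} → Graph n → Set
Acyclic G = ¬ HasCycle G

IsTree : ∀ {n} → Graph n → Set
IsTree G = Connected G × Acyclic G

degree : ∀ {n} → Graph n → Fin n → ℕ
degree {n} G v = length (filter (λ w → T? (adj G v w)) (allFin n))
  where open import Data.Bool.Properties using (T?)

leaves : ∀ {n} → Graph n → List (Fin n)
leaves {n} G = filter (λ v → degree G v ≟ℕ 1) (allFin n)

IsDiameter : ∀ {n} → Graph n → ℕ → Set
IsDiameter G d = Path G d × (∀ k → Path G k → k ≤ d)

-- Root the tree at a vertex r. Every other vertex u lies on the path from r to a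
-- leaf: extend the path from r to u beyond u for as long as possible, which stops
-- after at most diam(T) edges and only at a leaf. Since paths in a tree are
-- unique, u is recovered from that leaf and its distance to r, which lies in
-- 1, …, diam(T). Hence u ↦ (leaf, distance) is injective on V(T) − {r}.
module Submission where

open import Defs
open import Data.Nat using (ℕ; zero; suc; _≤_; _+_; _*_; z≤n; s≤s)
open import Data.Nat.Properties as ℕ using (≤-refl; ≤-trans; m≤m+n; +-suc; <-irrefl; n≤1+n)
open import Data.List using (List; []; _∷_; [_]; length; _++_; filter)
open import Data.List.Properties using (length-++; ++-assoc; ∷-injectiveʳ; filter-none)
open import Data.Fin using (Fin; fromℕ; fromℕ<; combine) renaming (zero to fzero; suc to fsuc)
open import Data.Fin.Properties using (any?; injective⇒≤; combine-injective; fromℕ<-injective; suc-injective)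
open import Data.Vec using (Vec; []; _∷_; lookup; toList)
open import Data.Vec.Relation.Unary.Linked using (Linked; [-]; _∷_)
open import Data.List.Relation.Unary.Unique.Propositional using (Unique)
open import Data.List.Relation.Unary.Unique.Propositional.Properties using (allFin⁺)
open import Data.List.Relation.Unary.AllPairs using ([]; _∷_)
import Data.List.Relation.Unary.All as All
open import Data.List.Relation.Unary.All.Properties using (¬Any⇒All¬; ++⁻ˡ)
open import Data.List.Relation.Unary.Any as Any using (here; there)
open import Data.List.Membership.Propositional using (_∈_)
open import Data.List.Membership.Propositional.Properties using (∈-allFin; ∈-filter⁺)
open import Data.List.Membership.Setoid.Properties using (index-injective)
import Data.List.Membership.DecPropositional as DecMembership
open import Data.Bool using (T)
open import Data.Bool.Properties using (T?)
open import Data.Product using (∃; _×_; _,_; proj₁; proj₂)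
open import Relation.Nullary using (¬_; yes; no; ¬?; contradiction)
open import Relation.Nullary.Decidable using (_×-dec_; decidable-stable)
open import Relation.Unary using (Pred; Decidable)
open import Relation.Binary.PropositionalEquality using (_≡_; refl; sym; trans; cong; subst; setoid; module ≡-Reasoning)

module _ {A : Set} where

  Unique-++⁻ˡ : ∀ xs {ys : List A} → Unique (xs ++ ys) → Unique xs
  Unique-++⁻ˡ []       _        = []
  Unique-++⁻ˡ (x ∷ xs) (x∉ ∷ u) = ++⁻ˡ xs x∉ ∷ Unique-++⁻ˡ xs u

  ++-cancelˡ-equal-length : ∀ (zs zs' : List A) {xs xs'} → length zs ≡ length zs' →
                            zs ++ xs ≡ zs' ++ xs' → xs ≡ xs'
  ++-cancelˡ-equal-length []       []        _       eq = eq
  ++-cancelˡ-equal-length (_ ∷ zs) (_ ∷ zs') len-eq eq =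
    ++-cancelˡ-equal-length zs zs' (ℕ.suc-injective len-eq) (∷-injectiveʳ eq)

  suffix-unique : ∀ {zs zs' xs xs' : List A} → zs ++ xs ≡ zs' ++ xs' →
                  length xs ≡ length xs' → xs ≡ xs'
  suffix-unique {zs} {zs'} {xs} {xs'} eq len-eq =
    ++-cancelˡ-equal-length zs zs' (ℕ.+-cancelʳ-≡ (length xs) _ _ prefix-lengths) eq
    where
    open ≡-Reasoning
    prefix-lengths : length zs + length xs ≡ length zs' + length xs
    prefix-lengths = begin
      length zs + length xs    ≡⟨ length-++ zs ⟨
      length (zs ++ xs)        ≡⟨ cong length eq ⟩
      length (zs' ++ xs')      ≡⟨ length-++ zs' ⟩
      length zs' + length xs'  ≡⟨ cong (length zs' +_) len-eq ⟨
      length zs' + length xs   ∎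

  length-filter≡1 : ∀ {p} {P : Pred A p} (P? : Decidable P) {xs x} → Unique xs → x ∈ xs → P x →
                    (∀ {y} → P y → y ≡ x) → length (filter P? xs) ≡ 1
  length-filter≡1 P? {y ∷ xs} (y∉ ∷ _) (here refl) Py only with P? y
  ... | yes _  = cong (λ ys → suc (length ys))
                   (filter-none P? (All.map (λ y≢z Pz → y≢z (sym (only Pz))) y∉))
  ... | no ¬Py = contradiction Py ¬Py
  length-filter≡1 P? {y ∷ xs} (y∉ ∷ u) (there x∈) Px only with P? y
  ... | yes Py = contradiction (subst (_∈ xs) (sym (only Py)) x∈) (λ y∈ → All.lookup y∉ y∈ refl)
  ... | no _   = length-filter≡1 P? u x∈ Px only

module Walks {n : ℕ} (G : Graph n) where

  open DecMembership (Data.Fin.Properties._≟_ {n}) using (_∈?_)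

  Adj-sym : ∀ {a b} → Adj G a b → Adj G b a
  Adj-sym {a} {b} = subst T (symmetric G a b)

  Adj-irrefl : ∀ {a} → ¬ Adj G a a
  Adj-irrefl {a} = subst T (loopless G a)

  data Walk : Fin n → Fin n → List (Fin n) → Set where
    stop : ∀ {a} → Walk a a [ a ]
    step : ∀ {a b c vs} → Adj G a b → Walk b c vs → Walk a c (a ∷ vs)

  len : ∀ {a b vs} → Walk a b vs → ℕ
  len stop       = 0
  len (step _ p) = suc (len p)

  length-vertices : ∀ {a b vs} (p : Walk a b vs) → length vs ≡ suc (len p)
  length-vertices stop       = refl
  length-vertices (step _ p) = cong suc (length-vertices p)

  end∈ : ∀ {a b vs} → Walk a b vs → b ∈ vs
  end∈ stop       = here refl
  end∈ (step _ p) = there (end∈ p)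

  start-unique : ∀ {a a' b b' vs} → Walk a b vs → Walk a' b' vs → a ≡ a'
  start-unique stop       stop       = refl
  start-unique stop       (step _ _) = refl
  start-unique (step _ _) stop       = refl
  start-unique (step _ _) (step _ _) = refl

  toVec : ∀ {a b vs} (p : Walk a b vs) → Vec (Fin n) (suc (len p))
  toVec {a} stop       = a ∷ []
  toVec {a} (step _ p) = a ∷ toVec p

  toList-toVec : ∀ {a b vs} (p : Walk a b vs) → toList (toVec p) ≡ vs
  toList-toVec stop           = refl
  toList-toVec {a} (step _ p) = cong (a ∷_) (toList-toVec p)

  lookup-last-toVec : ∀ {a b vs} (p : Walk a b vs) → lookup (toVec p) (fromℕ (len p)) ≡ b
  lookup-last-toVec stop       = refl
  lookup-last-toVec (step _ p) = lookup-last-toVec p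

  toVec-linked : ∀ {a b vs} (p : Walk a b vs) → Linked (Adj G) (toVec p)
  toVec-linked stop                = [-]
  toVec-linked (step e stop)       = e ∷ [-]
  toVec-linked (step e (step f p)) = e ∷ toVec-linked (step f p)

  toPath : ∀ {a b vs} (p : Walk a b vs) → Unique vs → Path G (len p)
  toPath p u = record
    { verts    = toVec p
    ; adjacent = toVec-linked p
    ; distinct = subst Unique (sym (toList-toVec p)) u
    }

  fromVec : ∀ {k} (xs : Vec (Fin n) (suc k)) → Linked (Adj G) xs →
            Walk (lookup xs fzero) (lookup xs (fromℕ k)) (toList xs)
  fromVec {zero}  (x ∷ [])     _       = stop
  fromVec {suc k} (x ∷ y ∷ ys) (e ∷ l) = step e (fromVec (y ∷ ys) l)

  fromPath : ∀ {k a b} (P : Path G k) → lookup (verts P) fzero ≡ a →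
             lookup (verts P) (fromℕ k) ≡ b → Walk a b (toList (verts P))
  fromPath P refl refl = fromVec (verts P) (adjacent P)

  splitAt∈ : ∀ {a b c vs} → Walk a b vs → c ∈ vs →
             ∃ λ zs → ∃ λ ws → Walk a c zs × vs ≡ zs ++ ws
  splitAt∈ stop                 (here refl) = _ , [] , stop , refl
  splitAt∈ (step {vs = vs} _ _) (here refl) = _ , vs , stop , refl
  splitAt∈ {a} (step e p)       (there c∈)  with splitAt∈ p c∈
  ... | zs , ws , r , eq = a ∷ zs , ws , step e r , cong (a ∷_) eq

  module _ (acyclic : Acyclic G) where

    no-chord : ∀ {a b vs} (p : Walk a b vs) → Unique vs → 2 ≤ len p → ¬ Adj G b a
    no-chord p@(step _ (step _ q)) u _ ba =
      acyclic (len q , toPath p u , subst (λ z → Adj G z _) (sym (lookup-last-toVec p)) ba)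
    no-chord (step _ stop) _ (s≤s ()) _

    neighbour-on-walk : ∀ {a b c c' vs} (e : Adj G a c') (p : Walk c' b vs) →
                        Unique (a ∷ vs) → Adj G a c → c ∈ vs → c ≡ c'
    neighbour-on-walk e p u ac c∈ with splitAt∈ p c∈
    ... | zs , ws , stop , eq = refl
    ... | zs , ws , step f r , eq =
      contradiction (Adj-sym ac)
        (no-chord (step e (step f r)) (Unique-++⁻ˡ (_ ∷ zs) (subst (λ vs → Unique (_ ∷ vs)) eq u))
          (s≤s (s≤s z≤n)))

    -- Terminates because the second walk shrinks in every recursive call.
    walk-unique : ∀ {a b xs ys} → Walk a b xs → Unique xs → Walk a b ys → Unique ys → xs ≡ ys
    walk-unique stop _ stop _ = refl
    walk-unique stop _ (step _ q) (a∉ ∷ _) = contradiction refl (All.lookup a∉ (end∈ q))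
    walk-unique (step _ p) (a∉ ∷ _) stop _ = contradiction refl (All.lookup a∉ (end∈ p))
    walk-unique {a} {xs = _ ∷ xs} (step e p) up@(_ ∷ uxs) (step {b = c} f q) (a∉ys ∷ uys)
      with c ∈? xs
    ... | yes c∈ with refl ← neighbour-on-walk e p up f c∈ = cong (a ∷_) (walk-unique p uxs q uys)
    ... | no c∉ = contradiction (subst (a ∈_) (walk-unique p' up' q uys) (there (here refl)))
                                (λ a∈ → All.lookup a∉ys a∈ refl)
      where
      p' : Walk c _ (c ∷ a ∷ xs)
      p' = step (Adj-sym f) (step e p)
      up' : Unique (c ∷ a ∷ xs)
      up' = ¬Any⇒All¬ _ (λ { (here c≡a) → Adj-irrefl (subst (Adj G a) c≡a f) ; (there c∈) → c∉ c∈ })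
            ∷ up

    maximal-walk-start-is-leaf : ∀ {w b ys} (q : Walk w b ys) → Unique ys → 1 ≤ len q →
                                 (∀ {c} → Adj G w c → c ∈ ys) → degree G w ≡ 1
    maximal-walk-start-is-leaf {w} (step {b = c'} e q) u _ maximal =
      length-filter≡1 (λ c → T? (adj G w c)) (allFin⁺ n) (∈-allFin c') e only-neighbour
      where
      only-neighbour : ∀ {c} → Adj G w c → c ≡ c'
      only-neighbour wc with maximal wc
      ... | here refl = contradiction wc Adj-irrefl
      ... | there c∈  = neighbour-on-walk e q u wc c∈

  diameter-bound : ∀ {d} → IsDiameter G d → ∀ {a b vs} (p : Walk a b vs) → Unique vs → len p ≤ d
  diameter-bound D p u = proj₂ D (len p) (toPath p u)

  record MaximalExtension {a b xs} (p : Walk a b xs) : Set where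
    field
      start    : Fin n
      ys       : List (Fin n)
      walk     : Walk start b ys
      simple   : Unique ys
      prefix   : List (Fin n)
      suffix   : ys ≡ prefix ++ xs
      maximal  : ∀ {c} → Adj G start c → c ∈ ys
      longer   : len p ≤ len walk

  -- The fuel bounds how often p can still be prolonged before exceeding the diameter.
  extend : ∀ {d} → IsDiameter G d → ∀ fuel {a b xs} (p : Walk a b xs) → Unique xs →
           d ≤ fuel + len p → MaximalExtension p
  extend {d} D fuel {a} {xs = xs} p u bound with any? (λ c → T? (adj G a c) ×-dec ¬? (c ∈? xs))
  ... | no stuck = record
    { walk = p ; simple = u ; prefix = [] ; suffix = refl ; longer = ≤-refl
    ; maximal = λ {c} ac → decidable-stable (c ∈? xs) (λ c∉ → stuck (c , ac , c∉)) }
  ... | yes (c , ac , c∉) with fuel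
  ...   | zero = contradiction (≤-trans (diameter-bound D p' u') bound) (<-irrefl refl)
    where
    p' : Walk c _ (c ∷ xs)
    p' = step (Adj-sym ac) p
    u' : Unique (c ∷ xs)
    u' = ¬Any⇒All¬ _ c∉ ∷ u
  ...   | suc fuel' = record
    { walk = walk ; simple = simple ; maximal = maximal
    ; prefix = prefix ++ [ c ]
    ; suffix = trans suffix (sym (++-assoc prefix [ c ] xs))
    ; longer = ≤-trans (n≤1+n _) longer }
    where
    open MaximalExtension
      (extend D fuel' (step (Adj-sym ac) p) (¬Any⇒All¬ _ c∉ ∷ u) (subst (d ≤_) (sym (+-suc fuel' _)) bound))

module Encoding {n d : ℕ} (G : Graph (suc n)) (tree : IsTree G) (D : IsDiameter G d) where

  open Walks G

  root : Fin (suc n)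
  root = fzero

  walkToRoot : ∀ u → ∃ λ vs → Walk u root vs × Unique vs
  walkToRoot u with proj₁ tree u root
  ... | _ , P , first , last = toList (verts P) , fromPath P first last , distinct P

  toRoot : ∀ u → Walk u root (proj₁ (walkToRoot u))
  toRoot u = proj₁ (proj₂ (walkToRoot u))

  toRoot-simple : ∀ u → Unique (proj₁ (walkToRoot u))
  toRoot-simple u = proj₂ (proj₂ (walkToRoot u))

  L : ℕ
  L = length (leaves G)

  extension : ∀ {a xs} (p : Walk a root xs) → Unique xs → MaximalExtension p
  extension p u = extend D d p u (m≤m+n d _)

  open MaximalExtension

  extension-start∈leaves : ∀ {a xs} (p : Walk a root xs) (u : Unique xs) → 1 ≤ len p →
                           start (extension p u) ∈ leaves G
  extension-start∈leaves p u 1≤len = ∈-filter⁺ (λ v → degree G v ℕ.≟ 1) (∈-allFin _)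
    (maximal-walk-start-is-leaf (proj₂ tree) (walk E) (simple E) (≤-trans 1≤len (longer E)) (maximal E))
    where
    E : MaximalExtension p
    E = extension p u

  -- The root is coded by 0, a vertex u ≠ root by its leaf and dist(u, root) − 1.
  code : ∀ {a xs} (p : Walk a root xs) → Unique xs → Fin (suc (L * d))
  code stop       _ = fzero
  code (step e p) u = fsuc (combine (Any.index (extension-start∈leaves (step e p) u (s≤s z≤n)))
                                    (fromℕ< (diameter-bound D (step e p) u)))

  code-injective : ∀ {a a' xs xs'} (p : Walk a root xs) (u : Unique xs)
                   (p' : Walk a' root xs') (u' : Unique xs') → code p u ≡ code p' u' → xs ≡ xs'
  code-injective stop _ stop _ _ = refl
  code-injective stop _ (step _ _) _ ()
  code-injective (step _ _) _ stop _ ()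
  code-injective (step e p) u (step e' p') u' eq
    with same-leaf , same-length ← combine-injective _ _ _ _ (suc-injective eq) =
    suffix-unique (trans (sym (suffix E)) (trans same-path (suffix E')))
      (trans (length-vertices (step e p))
        (trans (cong (λ k → suc (suc k)) (fromℕ<-injective _ _ _ _ same-length))
          (sym (length-vertices (step e' p')))))
    where
    E : MaximalExtension (step e p)
    E = extension (step e p) u
    E' : MaximalExtension (step e' p')
    E' = extension (step e' p') u'
    same-start : start E ≡ start E'
    same-start = index-injective (setoid _) (extension-start∈leaves (step e p) u (s≤s z≤n))
                   (extension-start∈leaves (step e' p') u' (s≤s z≤n)) same-leaf
    same-path : ys E ≡ ys E'
    same-path = walk-unique (proj₂ tree) (walk E) (simple E)
      (subst (λ w → Walk w root (ys E')) (sym same-start) (walk E')) (simple E')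

  encode : Fin (suc n) → Fin (suc (L * d))
  encode u = code (toRoot u) (toRoot-simple u)

  encode-injective : ∀ {u u'} → encode u ≡ encode u' → u ≡ u'
  encode-injective {u} {u'} eq =
    start-unique (toRoot u) (subst (Walk u' root) (sym same-vertices) (toRoot u'))
    where
    same-vertices : proj₁ (walkToRoot u) ≡ proj₁ (walkToRoot u')
    same-vertices = code-injective (toRoot u) (toRoot-simple u) (toRoot u') (toRoot-simple u') eq

mainTheorem5 : ∀ (n : ℕ) (T : Graph n) (d : ℕ) → IsTree T → IsDiameter T d →
    n ≤ length (leaves T) * d + 1
mainTheorem5 zero    _ _ _    _ = z≤n
mainTheorem5 (suc n) G d tree D =
  subst (suc n ≤_) (ℕ.+-comm 1 (L * d)) (injective⇒≤ encode-injective)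
  where open Encoding G tree D
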